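{- Let $O$ be a set of Boolean functions. The following are equivalent: (1) $O\preceq \{\land,\lor,\top,\bot\}$ or $O\preceq\{\neg,\bot\}$; (2) every formula $\phi\in\mathrm{PL}_O$ is uniquely characterized with respect to $\mathrm{PL}_O$ by a finite set of labeled examples; (3) there is a function $f:\mathbb{N}\to\mathbb{N}$ such that for all finite sets $\textsc{prop}$ of propositional variables, every $\phi\in\mathrm{PL}_O[\textsc{prop}]$ is uniquely characterized with respect to $\mathrm{PL}_O[\textsc{prop}]$ by a set of $f(|\phi|_{\mathrm{dag}})$ labeled examples.
   Context: A Boolean function is a map $\{0,1\}^n\to\{0,1\}$ with $n\ge 1$; the constants $\top,\bot$ are treated as constant unary functions, and $\land,\lor,\neg$ denote the usual Boolean functions. For a set $O$ of Boolean functions, $\mathrm{PL}_O$ is the set of propositional formulas generated by $\phi::= x\mid f(\phi_1,\dots,\phi_n)$ with $x$ ranging over a fixed countably infinite set of propositional variables and $f\in O$ $n$-ary, with the obvious semantics; $\mathrm{PL}_O[\textsc{prop}]$ is the set of those $\mathrm{PL}_O$-formulas using only variables from $\textsc{prop}$. For sets $O,O'$ of Boolean functions, $O\preceq O'$ means that the clone generated by $O$ (the smallest set of Boolean functions containing $O$ and all projections and closed under composition) is contained in the clone generated by $O'$. A labeled example is a pair $(V,\mathrm{lab})$ with $V$ a truth assignment and $\mathrm{lab}\in\{0,1\}$; a formula $\phi$ fits it if $\phi$ evaluates to $\mathrm{lab}$ under $V$. A set $E$ of labeled examples uniquely characterizes $\phi$ with respect to a set of formulas $L$ (here $\mathrm{PL}_O$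 or $\mathrm{PL}_O[\textsc{prop}]$) if $\phi$ fits all of $E$ and every formula of $L$ fitting all of $E$ is logically equivalent to $\phi$. $|\phi|_{\mathrm{dag}}$ is the number of distinct subformulas of $\phi$. -}

module Defs where

open import Data.Bool using (Bool; true; false; _∧_; _∨_; not)
open import Data.Nat using (ℕ; zero; suc; _≤_)
open import Data.Fin using (Fin)
open import Data.Vec using (Vec; []; _∷_; lookup; tabulate)
open import Data.Vec.Relation.Unary.Any using (Any)
open import Data.List using (List; length)
open import Data.List.Relation.Unary.All using (All)
open import Data.List.Relation.Unary.Unique.Propositional using (Unique)
open import Data.List.Membership.Propositional using (_∈_)
open import Data.Product using (Σ; _×_; _,_; ∃)
open import Data.Sum using (_⊎_)
open import Data.Unit using (⊤)
open import Relation.Binary.PropositionalEquality using (_≡_)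

BoolFun : ℕ → Set
BoolFun n = Vec Bool n → Bool

AnyBoolFun : Set
AnyBoolFun = Σ ℕ BoolFun

data _≈F_ : AnyBoolFun → AnyBoolFun → Set where
  ext : ∀ {n} {f g : BoolFun n} → (∀ v → f v ≡ g v) → (n , f) ≈F (n , g)

-- A set O of Boolean functions (each of arity ≥ 1), presented as a family
-- of function symbols: symbol s denotes the Boolean function  fn s  of
-- arity  suc (ar s).  That this family is a *set* (no two symbols denote
-- the same function) is the predicate  IsSet  below.
record Ops : Set₁ where
  field
    Sym : Set
    ar  : Sym → ℕ
    fn  : (s : Sym) → BoolFun (suc (ar s))
open Ops public

IsSet : Ops → Set
IsSet O = ∀ s t → (suc (ar O s) , fn O s) ≈F (suc (ar O t) , fn O t) → s ≡ t

-- Clone O k h : the k-ary Boolean function h belongs to the clone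
-- generated by O: the smallest set of Boolean functions containing O and
-- all projections, closed under composition (and, being a set of
-- functions, under equality of functions).
data Clone (O : Ops) : (k : ℕ) → BoolFun k → Set where
  base : (s : Sym O) → Clone O (suc (ar O s)) (fn O s)
  proj : ∀ {k} (i : Fin k) → Clone O k (λ v → lookup v i)
  comp : ∀ {n k} {f : BoolFun n} {gs : Fin n → BoolFun k} →
         Clone O n f → (∀ i → Clone O k (gs i)) →
         Clone O k (λ v → f (tabulate (λ i → gs i v)))
  ext  : ∀ {k} {g h : BoolFun k} → Clone O k g → (∀ v → g v ≡ h v) →
         Clone O k h

_⪯_ : Ops → Ops → Set
O ⪯ O' = ∀ {k} {h : BoolFun k} → Clone O k h → Clone O' k h

-- The set {∧, ∨, ⊤, ⊥}  (⊤, ⊥ are the constant unary functions).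
data AOTBSym : Set where
  andS orS topS botS : AOTBSym

AndOrTopBot : Ops
AndOrTopBot = record { Sym = AOTBSym ; ar = a ; fn = f }
  where
  a : AOTBSym → ℕ
  a andS = 1
  a orS  = 1
  a topS = 0
  a botS = 0
  f : (s : AOTBSym) → BoolFun (suc (a s))
  f andS (x ∷ y ∷ []) = x ∧ y
  f orS  (x ∷ y ∷ []) = x ∨ y
  f topS (x ∷ [])     = true
  f botS (x ∷ [])     = false

data NBSym : Set where
  negS botS : NBSym

NegBot : Ops
NegBot = record { Sym = NBSym ; ar = a ; fn = f }
  where
  a : NBSym → ℕ
  a negS = 0
  a botS = 0
  f : (s : NBSym) → BoolFun (suc (a s))
  f negS (x ∷ []) = not x
  f botS (x ∷ []) = false

data Form (O : Ops) : Set where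
  var : ℕ → Form O
  app : (s : Sym O) → Vec (Form O) (suc (ar O s)) → Form O

Assignment : Set
Assignment = ℕ → Bool

mutual
  eval : ∀ {O} → Assignment → Form O → Bool
  eval V (var x)    = V x
  eval {O} V (app s args) = fn O s (evalVec V args)

  evalVec : ∀ {O n} → Assignment → Vec (Form O) n → Vec Bool n
  evalVec V []       = []
  evalVec V (φ ∷ φs) = eval V φ ∷ evalVec V φs

_≃_ : ∀ {O} → Form O → Form O → Set
φ ≃ ψ = ∀ V → eval V φ ≡ eval V ψ

data _⊑_ {O : Ops} : Form O → Form O → Set where
  here  : ∀ {φ} → φ ⊑ φ
  there : ∀ {ψ s} {args : Vec (Form O) (suc (ar O s))} →
          Any (ψ ⊑_) args → ψ ⊑ app s args

InPL : ∀ {O} → List ℕ → Form O → Set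
InPL prop φ = ∀ x → var x ⊑ φ → x ∈ prop

DagSize : ∀ {O} → Form O → ℕ → Set
DagSize {O} φ m =
  Σ (List (Form O)) λ xs →
    length xs ≡ m × Unique xs × All (_⊑ φ) xs × (∀ ψ → ψ ⊑ φ → ψ ∈ xs)

Example : Set
Example = Assignment × Bool

Fits : ∀ {O} → Form O → Example → Set
Fits φ (V , lab) = eval V φ ≡ lab

UniquelyCharacterizes : ∀ {O} → (Form O → Set) → List Example → Form O → Set
UniquelyCharacterizes {O} L E φ =
  All (Fits φ) E × (∀ ψ → L ψ → All (Fits ψ) E → φ ≃ ψ)

Cond1 : Ops → Set
Cond1 O = (O ⪯ AndOrTopBot) ⊎ (O ⪯ NegBot)

Cond2 : Ops → Set
Cond2 O = (φ : Form O) → ∃ λ (E : List Example) →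
            UniquelyCharacterizes (λ _ → ⊤) E φ

Cond3 : Ops → Set
Cond3 O = ∃ λ (f : ℕ → ℕ) →
  (prop : List ℕ) (φ : Form O) → InPL prop φ →
  (m : ℕ) → DagSize φ m →
  ∃ λ (E : List Example) → length E ≤ f m × UniquelyCharacterizes (InPL prop) E φ

-- Over {∧, ∨, ⊤, ⊥} every formula is monotone, and over {¬, ⊥} every formula is u(x) for a
-- variable x occurring in it and some u : Bool → Bool. In both cases φ is characterized by
-- the examples given by all assignments to its variables L, extended to the other variables
-- by the constant 0 or 1: an assignment V lies between its two extensions, and the
-- extension of V by the value of V at the variable of a competitor ψ agrees with V at the
-- variables of φ and of ψ. There are 2·2^|L| such examples, and |L| ≤ |φ|_dag.
--
-- Conversely, if O is in neither clone it contains a non-monotone function and one that is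
-- not essentially unary. From them we compose a ternary θ in the clone of O that hides a
-- dependency: θ(x, y, y) does not depend on y, but θ(x₀, 0, 1) ≠ θ(x₀, 0, 0). The
-- non-monotone function yields a ternary h with h(0,1,0) = 1 and h(0,1,1) = 0, and a term
-- over h hides a dependency unless h(x,x,x) = ¬x. Given negation, the other function e
-- hides one after negating some of its arguments if e(F) = e(¬F) for some F, and along a
-- coordinate to which it is sensitive if e is self-dual. Finally, given examples E for
-- φ = θ(p₀, p₁, p₁), two of the variables p₁, …, p_{2^|E|+1} take the same value in every
-- example (pigeonhole), so ψ = θ(p₀, p_i, p_j) fits E although ψ ≢ φ.
module Submission where

open import Defs
open import Axiom.DoubleNegationElimination using (em⇒dne)
open import Axiom.ExcludedMiddle using (ExcludedMiddle)
open import Data.Bool using (Bool; true; false; not; _∧_; _∨_; _≤_; f≤t; b≤b)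
open import Data.Bool.Properties
  using (≤-minimum; ≤-maximum; ≤-reflexive; not-involutive; ¬-not; not-¬) renaming (_≟_ to _≟ᵇ_)
open import Data.Fin using (Fin; zero; suc; toℕ; combine) renaming (_≟_ to _≟ᶠ_)
open import Data.Fin.Patterns using (0F; 1F; 2F)
open import Data.Fin.Properties using (toℕ<n; combine-injectiveˡ; combine-injectiveʳ; pigeonhole)
open import Data.List as List using (List; []; _∷_; _++_; length; mapMaybe; deduplicate; upTo)
open import Data.List.Properties using (length-++; length-map; length-mapMaybe)
open import Data.List.Membership.Propositional using (_∈_; _∉_)
open import Data.List.Membership.Propositional.Properties
  using (∈-++⁺ˡ; ∈-++⁺ʳ; ∈-++⁻; ∈-map⁺; ∈-deduplicate⁺; ∈-deduplicate⁻; ∈-upTo⁺)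
open import Data.List.Relation.Unary.All as All using (All; []; _∷_)
open import Data.List.Relation.Unary.All.Properties using (map⁺)
open import Data.List.Relation.Unary.Any as Any using (here; there)
open import Data.List.Relation.Unary.Any.Properties using (mapMaybe⁺) renaming (map⁺ to Any-map⁺)
open import Data.List.Relation.Unary.Unique.DecPropositional.Properties using (deduplicate-!)
open import Data.Maybe using (Maybe; just; nothing)
open import Data.Maybe.Relation.Unary.Any using (just)
open import Data.Nat as ℕ using (ℕ; zero; suc; _+_; _^_; _≟_; s≤s; z≤n)
open import Data.Nat.Properties as ℕ using (+-identityʳ; +-mono-≤; ^-monoʳ-≤; n<1+n; <⇒≢)
open import Data.List.Membership.DecPropositional _≟_ using (_∈?_)
open import Data.Product using (Σ-syntax; ∃; ∃₂; _×_; _,_; proj₁; proj₂)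
open import Data.Sum using (_⊎_; inj₁; inj₂; [_,_]′)
open import Data.Unit using (tt)
open import Data.Vec using (Vec; []; _∷_; lookup; tabulate; tail; map; replicate; _[_]≔_)
open import Data.Vec.Properties
  using ( lookup∘tabulate; tabulate∘lookup; tabulate-cong; tabulate-∘; map-replicate; map-[]≔
        ; []≔-lookup; lookup∘update; lookup∘update′ )
open import Data.Vec.Relation.Binary.Pointwise.Inductive as Pointwise using (Pointwise; []; _∷_; tabulate⁺)
import Data.Vec.Relation.Unary.Any as VecAny
open import Data.Vec.Relation.Unary.Any.Properties using (tabulate⁻)
open import Function using (id; _∘_; const)
open import Function.Bundles using (_⇔_; mk⇔)
open import Level using (0ℓ)
open import Relation.Binary.Definitions using (DecidableEquality)
open import Relation.Binary.PropositionalEquality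
open import Relation.Nullary using (¬_; yes; no; does; contradiction)
open import Relation.Nullary.Decidable using (dec-true; dec-false)

private variable
  O O′ : Ops
  k n : ℕ
  a b c d : Bool
  V W : Assignment
  L : List ℕ
  F v : Vec Bool n


⪯-fromGenerators : (∀ s → Clone O′ (suc (ar O s)) (fn O s)) → O ⪯ O′
⪯-fromGenerators gen (base s)    = gen s
⪯-fromGenerators gen (proj i)    = proj i
⪯-fromGenerators gen (comp f gs) = comp (⪯-fromGenerators gen f) (⪯-fromGenerators gen ∘ gs)
⪯-fromGenerators gen (ext g g≗h) = ext (⪯-fromGenerators gen g) g≗h

clone-weaken : {h : BoolFun k} → Clone O k h → Clone O (suc k) (h ∘ tail)
clone-weaken {h = h} c = ext (comp c (proj ∘ suc)) λ where
  (_ ∷ w) → cong h (tabulate∘lookup w)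

clone-binary : {f : BoolFun 2} {g₁ g₂ : BoolFun k} →
               Clone O 2 f → Clone O k g₁ → Clone O k g₂ →
               Clone O k (λ w → f (g₁ w ∷ g₂ w ∷ []))
clone-binary {g₁ = g₁} {g₂} cf c₁ c₂ =
  comp {gs = λ where 0F → g₁; 1F → g₂} cf λ where
    0F → c₁
    1F → c₂

-- Monotone functions and the clone of {∧, ∨, ⊤, ⊥}

∧-mono-≤ : a ≤ b → c ≤ d → a ∧ c ≤ b ∧ d
∧-mono-≤ f≤t     _ = ≤-minimum _
∧-mono-≤ {false} b≤b _ = b≤b
∧-mono-≤ {true}  b≤b q = q

∨-mono-≤ : a ≤ b → c ≤ d → a ∨ c ≤ b ∨ d
∨-mono-≤ f≤t     _ = ≤-maximum _
∨-mono-≤ {false} b≤b q = q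
∨-mono-≤ {true}  b≤b _ = b≤b

∨-absorbs-≤ : a ≤ b → b ∨ a ≡ b
∨-absorbs-≤ f≤t         = refl
∨-absorbs-≤ {false} b≤b = refl
∨-absorbs-≤ {true}  b≤b = refl

≤-squeeze : a ≤ b → b ≤ c → a ≡ c → a ≡ b
≤-squeeze b≤b _   _  = refl
≤-squeeze f≤t b≤b ()

Monotone : BoolFun n → Set
Monotone f = ∀ {u v} → Pointwise _≤_ u v → f u ≤ f v

NonMonotone : BoolFun n → Set
NonMonotone f = ∃₂ λ u v → Pointwise _≤_ u v × f u ≡ true × f v ≡ false

¬nonMonotone⇒monotone : {f : BoolFun n} → ¬ NonMonotone f → Monotone f
¬nonMonotone⇒monotone {f = f} ¬nm {u} {v} u≤v with f u in fu | f v in fv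
... | false | _     = ≤-minimum _
... | true  | true  = b≤b
... | true  | false = contradiction (u , v , u≤v , fu , fv) ¬nm

clone-monotone : {h : BoolFun k} → Clone AndOrTopBot k h → Monotone h
clone-monotone (base andS)  (p ∷ q ∷ []) = ∧-mono-≤ p q
clone-monotone (base orS)   (p ∷ q ∷ []) = ∨-mono-≤ p q
clone-monotone (base topS)  (_ ∷ [])     = b≤b
clone-monotone (base botS)  (_ ∷ [])     = b≤b
clone-monotone (proj i)     u≤v          = Pointwise.lookup u≤v i
clone-monotone (comp f gs)  u≤v          = clone-monotone f (tabulate⁺ λ i → clone-monotone (gs i) u≤v)
clone-monotone (ext g g≗h) {u} {v} u≤v   = subst₂ _≤_ (g≗h u) (g≗h v) (clone-monotone g u≤v)

constant-monotone : (c : Bool) → Clone AndOrTopBot (suc k) (λ _ → c)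
constant-monotone true  = comp (base topS) λ _ → proj 0F
constant-monotone false = comp (base botS) λ _ → proj 0F

shannon-monotone : {h : BoolFun (suc k)} → Monotone h →
                   ∀ x w → (x ∧ h (true ∷ w)) ∨ h (false ∷ w) ≡ h (x ∷ w)
shannon-monotone mono false w = refl
shannon-monotone mono true  w = ∨-absorbs-≤ (mono (f≤t ∷ Pointwise.refl b≤b))

mutual
  monotone⇒clone : {h : BoolFun (suc k)} → Monotone h → Clone AndOrTopBot (suc k) h
  monotone⇒clone {k} {h} mono =
    ext (clone-binary (base orS) (clone-binary (base andS) (proj 0F) (slice true)) (slice false))
        λ where (x ∷ w) → shannon-monotone mono x w
    where
    slice : ∀ b → Clone AndOrTopBot (suc k) (λ w → h (b ∷ tail w))
    slice b = monotone-tail k λ w≤w′ → mono (b≤b ∷ w≤w′)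

  monotone-tail : ∀ k {g : BoolFun k} → Monotone g → Clone AndOrTopBot (suc k) (g ∘ tail)
  monotone-tail zero    {g} _    = ext (constant-monotone (g [])) λ where (_ ∷ []) → refl
  monotone-tail (suc k)     mono = clone-weaken (monotone⇒clone mono)

-- Essentially unary functions and the clone of {¬, ⊥}

EssentiallyUnary : BoolFun k → Set
EssentiallyUnary {k} h = Σ[ i ∈ Fin k ] Σ[ u ∈ (Bool → Bool) ] (∀ w → h w ≡ u (lookup w i))

clone-essentiallyUnary : {h : BoolFun k} → Clone NegBot k h → EssentiallyUnary h
clone-essentiallyUnary (base negS) = 0F , not , λ where (_ ∷ []) → refl
clone-essentiallyUnary (base botS) = 0F , const false , λ where (_ ∷ []) → refl
clone-essentiallyUnary (proj i)    = i , id , λ _ → refl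
clone-essentiallyUnary (comp {gs = gs} f cgs) with clone-essentiallyUnary f
... | i , u , f≡u with clone-essentiallyUnary (cgs i)
...   | j , u′ , g≡u′ = j , u ∘ u′ , λ w →
        trans (f≡u _) (cong u (trans (lookup∘tabulate (λ i → gs i w) i) (g≡u′ w)))
clone-essentiallyUnary (ext g g≗h) with clone-essentiallyUnary g
... | i , u , g≡u = i , u , λ w → trans (sym (g≗h w)) (g≡u w)

unary-cases : (u : Bool → Bool) →
              (∃ λ c → ∀ x → u x ≡ c) ⊎ (∀ x → u x ≡ x) ⊎ (∀ x → u x ≡ not x)
unary-cases u with u false in u0 | u true in u1
... | false | false = inj₁ (false , λ where false → u0; true → u1)
... | true  | true  = inj₁ (true  , λ where false → u0; true → u1)
... | false | true  = inj₂ (inj₁ λ where false → u0; true → u1)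
... | true  | false = inj₂ (inj₂ λ where false → u0; true → u1)

negate-NegBot : {g : BoolFun k} → Clone NegBot k g → Clone NegBot k (not ∘ g)
negate-NegBot c = comp (base negS) λ _ → c

constant-NegBot : Fin k → (c : Bool) → Clone NegBot k (λ _ → c)
constant-NegBot i false = comp (base botS) λ _ → proj i
constant-NegBot i true  = negate-NegBot (constant-NegBot i false)

essentiallyUnary⇒clone : {h : BoolFun k} → EssentiallyUnary h → Clone NegBot k h
essentiallyUnary⇒clone (i , u , h≡u) with unary-cases u
... | inj₁ (c , u≡c)   = ext (constant-NegBot i c) λ w → sym (trans (h≡u w) (u≡c _))
... | inj₂ (inj₁ u≡id) = ext (proj i) λ w → sym (trans (h≡u w) (u≡id _))
... | inj₂ (inj₂ u≡¬)  = ext (negate-NegBot (proj i)) λ w → sym (trans (h≡u w) (u≡¬ _))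

module _ {O : Ops} where

  mutual
    eval-local : (φ : Form O) → (∀ x → var x ⊑ φ → V x ≡ W x) → eval V φ ≡ eval W φ
    eval-local (var x)      V≡W = V≡W x here
    eval-local (app s args) V≡W = cong (fn O s) (evalVec-local args λ x → V≡W x ∘ there)

    evalVec-local : (φs : Vec (Form O) n) → (∀ x → VecAny.Any (var x ⊑_) φs → V x ≡ W x) →
                    evalVec V φs ≡ evalVec W φs
    evalVec-local []       _   = refl
    evalVec-local (φ ∷ φs) V≡W =
      cong₂ _∷_ (eval-local φ λ x → V≡W x ∘ VecAny.here)
                (evalVec-local φs λ x → V≡W x ∘ VecAny.there)

  module _ (mono : ∀ s → Monotone (fn O s)) (V≤W : ∀ x → V x ≤ W x) where
    mutual
      eval-monotone : (φ : Form O) → eval V φ ≤ eval W φ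
      eval-monotone (var x)      = V≤W x
      eval-monotone (app s args) = mono s (evalVec-monotone args)

      evalVec-monotone : (φs : Vec (Form O) n) → Pointwise _≤_ (evalVec V φs) (evalVec W φs)
      evalVec-monotone []       = []
      evalVec-monotone (φ ∷ φs) = eval-monotone φ ∷ evalVec-monotone φs

  module _ (unary : ∀ s → EssentiallyUnary (fn O s)) where
    mutual
      eval-essentiallyUnary : (φ : Form O) →
        Σ[ x ∈ ℕ ] Σ[ u ∈ (Bool → Bool) ] var x ⊑ φ × (∀ V → eval V φ ≡ u (V x))
      eval-essentiallyUnary (var x) = x , id , here , λ _ → refl
      eval-essentiallyUnary (app s args) with unary s
      ... | i , u , fn≡u with evalVec-essentiallyUnary args i
      ...   | x , u′ , x⊑ , ≡u′ =
        x , u ∘ u′ , there x⊑ , λ V → trans (fn≡u _) (cong u (≡u′ V))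

      evalVec-essentiallyUnary : (φs : Vec (Form O) n) (i : Fin n) →
        Σ[ x ∈ ℕ ] Σ[ u ∈ (Bool → Bool) ]
          VecAny.Any (var x ⊑_) φs × (∀ V → lookup (evalVec V φs) i ≡ u (V x))
      evalVec-essentiallyUnary (φ ∷ _) zero with eval-essentiallyUnary φ
      ... | x , u , x⊑ , ≡u = x , u , VecAny.here x⊑ , ≡u
      evalVec-essentiallyUnary (_ ∷ φs) (suc i) with evalVec-essentiallyUnary φs i
      ... | x , u , x⊑ , ≡u = x , u , VecAny.there x⊑ , ≡u

  evalVec-tabulate : (V : Assignment) (φs : Fin k → Form O) →
                     evalVec V (tabulate φs) ≡ tabulate (eval V ∘ φs)
  evalVec-tabulate {zero}  V φs = refl
  evalVec-tabulate {suc k} V φs = cong (eval V (φs zero) ∷_) (evalVec-tabulate V (φs ∘ suc))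

  record Realization (h : BoolFun k) (args : Fin k → Form O) : Set where
    field
      formula      : Form O
      eval-formula : ∀ V → eval V formula ≡ h (tabulate (eval V ∘ args))
      vars-formula : ∀ x → var x ⊑ formula → ∃ λ i → var x ⊑ args i

  realize : {h : BoolFun k} → Clone O k h → (args : Fin k → Form O) → Realization h args
  realize (base s) args = record
    { formula      = app s (tabulate args)
    ; eval-formula = λ V → cong (fn O s) (evalVec-tabulate V args)
    ; vars-formula = λ where x (there x⊑) → tabulate⁻ x⊑
    }
  realize (proj i) args = record
    { formula      = args i
    ; eval-formula = λ V → sym (lookup∘tabulate _ i)
    ; vars-formula = λ x x⊑ → i , x⊑
    }
  realize (comp {f = f} cf cgs) args = record
    { formula      = formula outer
    ; eval-formula = λ V →
        trans (eval-formula outer V) (cong f (tabulate-cong λ i → eval-formula (inner i) V))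
    ; vars-formula = λ x x⊑ →
        let i , x⊑ᵢ = vars-formula outer x x⊑ in vars-formula (inner i) x x⊑ᵢ
    }
    where
    open Realization
    inner : ∀ i → Realization _ args
    inner i = realize (cgs i) args
    outer : Realization f (formula ∘ inner)
    outer = realize cf (formula ∘ inner)
  realize (ext cg g≗h) args = record
    { formula      = formula r
    ; eval-formula = λ V → trans (eval-formula r V) (g≗h _)
    ; vars-formula = vars-formula r
    }
    where
    open Realization
    r : Realization _ args
    r = realize cg args

  mutual
    subformulas : Form O → List (Form O)
    subformulas (var x)      = var x ∷ []
    subformulas (app s args) = app s args ∷ subformulasVec args

    subformulasVec : Vec (Form O) n → List (Form O)
    subformulasVec []       = []
    subformulasVec (φ ∷ φs) = subformulas φ ++ subformulasVec φs

  mutual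
    ∈-subformulas⁺ : {ψ : Form O} (φ : Form O) → ψ ⊑ φ → ψ ∈ subformulas φ
    ∈-subformulas⁺ (var x)      here      = here refl
    ∈-subformulas⁺ (app s args) here      = here refl
    ∈-subformulas⁺ (app s args) (there p) = there (∈-subformulasVec⁺ args p)

    ∈-subformulasVec⁺ : {ψ : Form O} (φs : Vec (Form O) n) →
                        VecAny.Any (ψ ⊑_) φs → ψ ∈ subformulasVec φs
    ∈-subformulasVec⁺ (φ ∷ φs) (VecAny.here p)  = ∈-++⁺ˡ (∈-subformulas⁺ φ p)
    ∈-subformulasVec⁺ (φ ∷ φs) (VecAny.there p) = ∈-++⁺ʳ (subformulas φ) (∈-subformulasVec⁺ φs p)

  mutual
    ∈-subformulas⁻ : {ψ : Form O} (φ : Form O) → ψ ∈ subformulas φ → ψ ⊑ φ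
    ∈-subformulas⁻ (var x)      (here refl) = here
    ∈-subformulas⁻ (app s args) (here refl) = here
    ∈-subformulas⁻ (app s args) (there p)   = there (∈-subformulasVec⁻ args p)

    ∈-subformulasVec⁻ : {ψ : Form O} (φs : Vec (Form O) n) →
                        ψ ∈ subformulasVec φs → VecAny.Any (ψ ⊑_) φs
    ∈-subformulasVec⁻ (φ ∷ φs) p with ∈-++⁻ (subformulas φ) p
    ... | inj₁ q = VecAny.here (∈-subformulas⁻ φ q)
    ... | inj₂ q = VecAny.there (∈-subformulasVec⁻ φs q)

  -- Formulas have decidable equality only when the symbols do; excluded middle provides it.
  dagSize : ExcludedMiddle 0ℓ → (φ : Form O) → ∃ (DagSize φ)
  dagSize lem φ = length subs , subs , refl , deduplicate-! formula-≟ (subformulas φ)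
                , All.tabulate (∈-subformulas⁻ φ ∘ ∈-deduplicate⁻ formula-≟ (subformulas φ))
                , λ ψ ψ⊑φ → ∈-deduplicate⁺ formula-≟ (∈-subformulas⁺ φ ψ⊑φ)
    where
    formula-≟ : DecidableEquality (Form O)
    formula-≟ φ ψ = lem
    subs : List (Form O)
    subs = deduplicate formula-≟ (subformulas φ)

  variableOf : Form O → Maybe ℕ
  variableOf (var x)   = just x
  variableOf (app _ _) = nothing

  variables : List (Form O) → List ℕ
  variables = mapMaybe variableOf

  ∈-variables⁺ : ∀ {x} {φs : List (Form O)} → var x ∈ φs → x ∈ variables φs
  ∈-variables⁺ {φs = φs} x∈ =
    mapMaybe⁺ variableOf φs (Any-map⁺ (Any.map (λ where refl → just refl) x∈))

  length-variables : (φs : List (Form O)) → length (variables φs) ℕ.≤ length φs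
  length-variables = length-mapMaybe variableOf

-- Characterizing examples

update : ℕ → Bool → Assignment → Assignment
update x b W y with y ≟ x
... | yes _ = b
... | no  _ = W y

assignmentsOn : List ℕ → Bool → List Assignment
assignmentsOn []      d = const d ∷ []
assignmentsOn (x ∷ L) d =
  List.map (update x false) (assignmentsOn L d) ++ List.map (update x true) (assignmentsOn L d)

length-assignmentsOn : ∀ L d → length (assignmentsOn L d) ≡ 2 ^ length L
length-assignmentsOn []      d = refl
length-assignmentsOn (x ∷ L) d = begin
  length (List.map (update x false) Ws ++ List.map (update x true) Ws)
    ≡⟨ length-++ (List.map (update x false) Ws) ⟩
  length (List.map (update x false) Ws) + length (List.map (update x true) Ws)
    ≡⟨ cong₂ _+_ (length-map _ Ws) (trans (length-map _ Ws) (sym (+-identityʳ _))) ⟩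
  length Ws + (length Ws + 0)
    ≡⟨ cong (λ n → n + (n + 0)) (length-assignmentsOn L d) ⟩
  2 ^ length (x ∷ L) ∎
  where
  open ≡-Reasoning
  Ws : List Assignment
  Ws = assignmentsOn L d

Patched : List ℕ → Assignment → Bool → Assignment → Set
Patched L V d W = (∀ {y} → y ∈ L → W y ≡ V y) × (∀ {y} → y ∉ L → W y ≡ d)

patched-cases : Patched L V d W → ∀ y → W y ≡ V y ⊎ W y ≡ d
patched-cases {L} (on , off) y with y ∈? L
... | yes y∈L = inj₁ (on y∈L)
... | no  y∉L = inj₂ (off y∉L)

patch∈assignmentsOn : ∀ L d V → ∃ λ W → W ∈ assignmentsOn L d × Patched L V d W
patch∈assignmentsOn []      d V = const d , here refl , (λ ()) , λ _ → refl
patch∈assignmentsOn (x ∷ L) d V with patch∈assignmentsOn L d V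
... | W , W∈ , on , off = update x (V x) W , updated∈ (V x) , on′ , off′
  where
  updated∈ : ∀ b → update x b W ∈ assignmentsOn (x ∷ L) d
  updated∈ false = ∈-++⁺ˡ (∈-map⁺ (update x false) W∈)
  updated∈ true  = ∈-++⁺ʳ _ (∈-map⁺ (update x true) W∈)
  on′ : ∀ {y} → y ∈ x ∷ L → update x (V x) W y ≡ V y
  on′ {y} y∈ with y ≟ x
  on′ _          | yes refl = refl
  on′ (here y≡x) | no  y≢x  = contradiction y≡x y≢x
  on′ (there y∈) | no  _    = on y∈
  off′ : ∀ {y} → y ∉ x ∷ L → update x (V x) W y ≡ d
  off′ {y} y∉ with y ≟ x
  ... | yes y≡x = contradiction (here y≡x) y∉
  ... | no  _   = off (y∉ ∘ there)

module _ {O : Ops} where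

  examples : Form O → List ℕ → List Example
  examples φ L = List.map (λ W → W , eval W φ) (assignmentsOn L false ++ assignmentsOn L true)

  length-examples : (φ : Form O) (L : List ℕ) → length (examples φ L) ≡ 2 ^ length L + 2 ^ length L
  length-examples φ L = begin
    length (examples φ L)
      ≡⟨ length-map _ (assignmentsOn L false ++ _) ⟩
    length (assignmentsOn L false ++ assignmentsOn L true)
      ≡⟨ length-++ (assignmentsOn L false) ⟩
    length (assignmentsOn L false) + length (assignmentsOn L true)
      ≡⟨ cong₂ _+_ (length-assignmentsOn L false) (length-assignmentsOn L true) ⟩
    2 ^ length L + 2 ^ length L ∎
    where open ≡-Reasoning

  examples-fit : (φ : Form O) (L : List ℕ) → All (Fits φ) (examples φ L)
  examples-fit φ L = map⁺ (All.tabulate λ _ → refl)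

  module _ {L : List ℕ} (φ ψ : Form O) (φ∈PL : InPL L φ) (fits : All (Fits ψ) (examples φ L)) where
    open ≡-Reasoning

    fit⇒patch : ∀ d V → ∃ λ W → Patched L V d W × eval W ψ ≡ eval W φ
    fit⇒patch d V with patch∈assignmentsOn L d V
    ... | W , W∈ , patch = W , patch , All.lookup fits (∈-map⁺ (λ W → W , eval W φ) (∈-both d W∈))
      where
      ∈-both : ∀ d → W ∈ assignmentsOn L d → W ∈ assignmentsOn L false ++ assignmentsOn L true
      ∈-both false = ∈-++⁺ˡ
      ∈-both true  = ∈-++⁺ʳ _

    eval-patched : Patched L V d W → eval V φ ≡ eval W φ
    eval-patched (on , _) = eval-local φ λ x x⊑φ → sym (on (φ∈PL x x⊑φ))

    -- V lies between its patches by false and by true, where φ, hence ψ, takes the value φ(V).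
    monotone-characterized : (∀ s → Monotone (fn O s)) → φ ≃ ψ
    monotone-characterized mono V with fit⇒patch false V | fit⇒patch true V
    ... | W₀ , patch₀ , ψ≡φ₀ | W₁ , patch₁ , ψ≡φ₁ = begin
      eval V φ   ≡⟨ eval-patched patch₀ ⟩
      eval W₀ φ  ≡⟨ ψ≡φ₀ ⟨
      eval W₀ ψ  ≡⟨ ≤-squeeze (eval-monotone mono W₀≤V ψ) (eval-monotone mono V≤W₁ ψ) ends ⟩
      eval V ψ   ∎
      where
      W₀≤V : ∀ y → W₀ y ≤ V y
      W₀≤V y = [ ≤-reflexive , (λ W₀y≡false → subst (_≤ V y) (sym W₀y≡false) (≤-minimum _)) ]′
                 (patched-cases patch₀ y)
      V≤W₁ : ∀ y → V y ≤ W₁ y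
      V≤W₁ y = [ ≤-reflexive ∘ sym , (λ W₁y≡true → subst (V y ≤_) (sym W₁y≡true) (≤-maximum _)) ]′
                 (patched-cases patch₁ y)
      ends : eval W₀ ψ ≡ eval W₁ ψ
      ends = begin
        eval W₀ ψ  ≡⟨ ψ≡φ₀ ⟩
        eval W₀ φ  ≡⟨ eval-patched patch₀ ⟨
        eval V φ   ≡⟨ eval-patched patch₁ ⟩
        eval W₁ φ  ≡⟨ ψ≡φ₁ ⟨
        eval W₁ ψ  ∎

    -- Patching V by V y keeps the variables x of φ and y of ψ at their values under V.
    unary-characterized : (∀ s → EssentiallyUnary (fn O s)) → φ ≃ ψ
    unary-characterized unary V
      with eval-essentiallyUnary unary φ | eval-essentiallyUnary unary ψ
    ... | x , u , x⊑φ , φ≡u | y , u′ , _ , ψ≡u′ with fit⇒patch (V y) V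
    ...   | W , patch , ψ≡φ = begin
      eval V φ   ≡⟨ φ≡u V ⟩
      u (V x)    ≡⟨ cong u (proj₁ patch (φ∈PL x x⊑φ)) ⟨
      u (W x)    ≡⟨ φ≡u W ⟨
      eval W φ   ≡⟨ ψ≡φ ⟨
      eval W ψ   ≡⟨ ψ≡u′ W ⟩
      u′ (W y)   ≡⟨ cong u′ ([ id , id ]′ (patched-cases patch y)) ⟩
      u′ (V y)   ≡⟨ ψ≡u′ V ⟨
      eval V ψ   ∎

  cond1-characterized : {L : List ℕ} → Cond1 O → (φ ψ : Form O) →
                        InPL L φ → All (Fits ψ) (examples φ L) → φ ≃ ψ
  cond1-characterized (inj₁ O⪯M) φ ψ φ∈PL fits =
    monotone-characterized φ ψ φ∈PL fits λ s → clone-monotone (O⪯M (base s))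
  cond1-characterized (inj₂ O⪯N) φ ψ φ∈PL fits =
    unary-characterized φ ψ φ∈PL fits λ s → clone-essentiallyUnary (O⪯N (base s))

  cond1⇒cond2 : Cond1 O → Cond2 O
  cond1⇒cond2 c1 φ =
    examples φ vars , examples-fit φ vars , λ ψ _ → cond1-characterized c1 φ ψ φ∈PL
    where
    vars : List ℕ
    vars = variables (subformulas φ)
    φ∈PL : InPL vars φ
    φ∈PL x x⊑φ = ∈-variables⁺ (∈-subformulas⁺ φ x⊑φ)

  cond1⇒cond3 : Cond1 O → Cond3 O
  cond1⇒cond3 c1 = (λ m → 2 ^ m + 2 ^ m) , λ where
    _ φ _ m (φs , |φs|≡m , _ , _ , complete) →
      let L = variables φs
          2^L≤2^m = ^-monoʳ-≤ 2 (ℕ.≤-trans (length-variables φs) (ℕ.≤-reflexive |φs|≡m))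
      in examples φ L
       , subst (ℕ._≤ 2 ^ m + 2 ^ m) (sym (length-examples φ L)) (+-mono-≤ 2^L≤2^m 2^L≤2^m)
       , examples-fit φ L
       , λ ψ _ → cond1-characterized c1 φ ψ λ x x⊑φ → ∈-variables⁺ (complete (var x) x⊑φ)

-- Hidden dependencies

Ternary : Set
Ternary = Bool → Bool → Bool → Bool

ternary : Ternary → BoolFun 3
ternary θ w = θ (lookup w 0F) (lookup w 1F) (lookup w 2F)

HidesDependency : Ternary → Bool → Set
HidesDependency θ x₀ =
  (∀ x → θ x false false ≡ θ x true true) × θ x₀ false true ≢ θ x₀ false false

record HiddenDependency (O : Ops) : Set where
  field
    θ     : Ternary
    θ∈O   : Clone O 3 (ternary θ)
    x₀    : Bool
    hides : HidesDependency θ x₀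

hides-cong : {θ θ′ : Ternary} {x₀ : Bool} → (∀ x y z → θ x y z ≡ θ′ x y z) →
             HidesDependency θ x₀ → HidesDependency θ′ x₀
hides-cong θ≗θ′ (diagonal , offDiagonal) =
  (λ x → trans (sym (θ≗θ′ _ _ _)) (trans (diagonal x) (θ≗θ′ _ _ _))) ,
  (λ eq → offDiagonal (trans (θ≗θ′ _ _ _) (trans eq (sym (θ≗θ′ _ _ _)))))

clone-ternary : {T : Ternary} {f g h : BoolFun k} → Clone O 3 (ternary T) →
                Clone O k f → Clone O k g → Clone O k h → Clone O k (λ w → T (f w) (g w) (h w))
clone-ternary {f = f} {g} {h} cT cf cg ch =
  comp {gs = λ where 0F → f; 1F → g; 2F → h} cT λ where
    0F → cf
    1F → cg
    2F → ch

HasNegation : Ops → Set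
HasNegation O = Clone O 1 (λ w → not (lookup w 0F))

negate : HasNegation O → {g : BoolFun k} → Clone O k g → Clone O k (not ∘ g)
negate neg c = comp neg λ _ → c

data Term₃ : Set where
  ‵x ‵y ‵z : Term₃
  ‵h       : Term₃ → Term₃ → Term₃ → Term₃

⟦_⟧ : Term₃ → Ternary → Ternary
⟦ ‵x ⟧       T x y z = x
⟦ ‵y ⟧       T x y z = y
⟦ ‵z ⟧       T x y z = z
⟦ ‵h a b c ⟧ T x y z = T (⟦ a ⟧ T x y z) (⟦ b ⟧ T x y z) (⟦ c ⟧ T x y z)

⟦⟧-cong : {T T′ : Ternary} → (∀ x y z → T x y z ≡ T′ x y z) →
          ∀ t x y z → ⟦ t ⟧ T x y z ≡ ⟦ t ⟧ T′ x y z
⟦⟧-cong T≗T′ ‵x x y z = refl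
⟦⟧-cong T≗T′ ‵y x y z = refl
⟦⟧-cong T≗T′ ‵z x y z = refl
⟦⟧-cong {T} T≗T′ (‵h a b c) x y z =
  trans (cong₂ (λ p q → T p q _) (⟦⟧-cong T≗T′ a x y z) (⟦⟧-cong T≗T′ b x y z))
        (trans (cong (T _ _) (⟦⟧-cong T≗T′ c x y z)) (T≗T′ _ _ _))

⟦⟧-clone : {T : Ternary} → Clone O 3 (ternary T) → ∀ t → Clone O 3 (ternary (⟦ t ⟧ T))
⟦⟧-clone cT ‵x         = proj 0F
⟦⟧-clone cT ‵y         = proj 1F
⟦⟧-clone cT ‵z         = proj 2F
⟦⟧-clone {T = T} cT (‵h a b c) =
  clone-ternary {T = T} cT (⟦⟧-clone cT a) (⟦⟧-clone cT b) (⟦⟧-clone cT c)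

-- The ternary functions with h(0,0,0) = 0, h(1,1,1) = 1, h(0,1,0) = 1 and h(0,1,1) = 0,
-- given by their values a, b, c, d at 001, 100, 101 and 110.
idempotentTable : (a b c d : Bool) → Ternary
idempotentTable _ _ _ _ false false false = false
idempotentTable a _ _ _ false false true  = a
idempotentTable _ _ _ _ false true  false = true
idempotentTable _ _ _ _ false true  true  = false
idempotentTable _ b _ _ true  false false = b
idempotentTable _ _ c _ true  false true  = c
idempotentTable _ _ _ d true  true  false = d
idempotentTable _ _ _ _ true  true  true  = true

hidingTerm : (a b c d : Bool) → Term₃ × Bool
hidingTerm _     true  _     _     = ‵h ‵x ‵z ‵y , false
hidingTerm _     false false _     = ‵h ‵y ‵x ‵z , true
hidingTerm true  false true  false = ‵h ‵y ‵z ‵x , false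
hidingTerm false false true  false = ‵h ‵x ‵x (‵h ‵y ‵x ‵z) , true
hidingTerm false false true  true  = ‵h ‵x ‵z (‵h ‵x ‵y ‵x) , false
hidingTerm true  false true  true  = ‵h ‵x ‵x (‵h ‵x ‵y ‵z) , false

hidingTerm-hides : ∀ a b c d → let t , x₀ = hidingTerm a b c d in
                   HidesDependency (⟦ t ⟧ (idempotentTable a b c d)) x₀
hidingTerm-hides _     true  _     _     = (λ where false → refl; true → refl) , λ ()
hidingTerm-hides _     false false _     = (λ where false → refl; true → refl) , λ ()
hidingTerm-hides true  false true  false = (λ where false → refl; true → refl) , λ ()
hidingTerm-hides false false true  false = (λ where false → refl; true → refl) , λ ()
hidingTerm-hides false false true  true  = (λ where false → refl; true → refl) , λ ()
hidingTerm-hides true  false true  true  = (λ where false → refl; true → refl) , λ ()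

idempotent⇒hidden : {h : Ternary} → Clone O 3 (ternary h) →
  h false false false ≡ false → h true true true ≡ true →
  h false true false ≡ true → h false true true ≡ false → HiddenDependency O
idempotent⇒hidden {h = h} ch h000 h111 h010 h011 = record
  { θ     = ⟦ t ⟧ h
  ; θ∈O   = ⟦⟧-clone ch t
  ; x₀    = x₀
  ; hides = hides-cong (λ x y z → sym (⟦⟧-cong h≗table t x y z)) (hidingTerm-hides h001 h100 h101 h110)
  }
  where
  h001 h100 h101 h110 : Bool
  h001 = h false false true
  h100 = h true false false
  h101 = h true false true
  h110 = h true true false
  t : Term₃
  t = proj₁ (hidingTerm h001 h100 h101 h110)
  x₀ : Bool
  x₀ = proj₂ (hidingTerm h001 h100 h101 h110)
  h≗table : ∀ x y z → h x y z ≡ idempotentTable h001 h100 h101 h110 x y z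
  h≗table false false false = h000
  h≗table false false true  = refl
  h≗table false true  false = h010
  h≗table false true  true  = h011
  h≗table true  false false = refl
  h≗table true  false true  = refl
  h≗table true  true  false = refl
  h≗table true  true  true  = h111

route : a ≤ b → Ternary
route {false} b≤b x _ _ = x
route {true}  b≤b _ y _ = y
route f≤t         _ _ z = z

route-010 : (p : a ≤ b) → route p false true false ≡ a
route-010 {false} b≤b = refl
route-010 {true}  b≤b = refl
route-010 f≤t         = refl

route-011 : (p : a ≤ b) → route p false true true ≡ b
route-011 {false} b≤b = refl
route-011 {true}  b≤b = refl
route-011 f≤t         = refl

clone-route : (p : a ≤ b) → Clone O 3 (ternary (route p))
clone-route {false} b≤b = proj 0F
clone-route {true}  b≤b = proj 1F
clone-route f≤t         = proj 2F

-- Coordinates where u and v are 0, 1, or 0 and 1 respectively become the arguments x, y and z.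
nonMonotone⇒ternary : {f : BoolFun n} → Clone O n f → NonMonotone f →
  ∃ λ h → Clone O 3 (ternary h) × h false true false ≡ true × h false true true ≡ false
nonMonotone⇒ternary {f = f} cf (u , v , u≤v , fu , fv) =
  h , comp cf (clone-route ∘ Pointwise.lookup u≤v) , trans h010 fu , trans h011 fv
  where
  h : Ternary
  h x y z = f (tabulate λ j → route (Pointwise.lookup u≤v j) x y z)
  h010 : h false true false ≡ f u
  h010 = cong f (trans (tabulate-cong (route-010 ∘ Pointwise.lookup u≤v)) (tabulate∘lookup u))
  h011 : h false true true ≡ f v
  h011 = cong f (trans (tabulate-cong (route-011 ∘ Pointwise.lookup u≤v)) (tabulate∘lookup v))

ternaryNonMonotone⇒hidden⊎negation : {h : Ternary} → Clone O 3 (ternary h) →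
  h false true false ≡ true → h false true true ≡ false → HiddenDependency O ⊎ HasNegation O
ternaryNonMonotone⇒hidden⊎negation {h = h} ch h010 h011
  with h false false false in h000 | h true true true in h111
... | false | false = inj₁ record
  { θ     = λ x y z → h y z y
  ; θ∈O   = clone-ternary {T = h} ch (proj 1F) (proj 2F) (proj 1F)
  ; x₀    = false
  ; hides = (λ _ → trans h000 (sym h111)) , λ eq → contradiction (trans (sym h010) (trans eq h000)) λ ()
  }
... | true  | true  = inj₁ record
  { θ     = λ x y z → h y z z
  ; θ∈O   = clone-ternary {T = h} ch (proj 1F) (proj 2F) (proj 2F)
  ; x₀    = false
  ; hides = (λ _ → trans h000 (sym h111)) , λ eq → contradiction (trans (sym h011) (trans eq h000)) λ ()
  }
... | false | true  = inj₁ (idempotent⇒hidden {h = h} ch h000 h111 h010 h011)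
... | true  | false =
  inj₂ (ext (clone-ternary {T = h} ch (proj 0F) (proj 0F) (proj 0F)) λ w → h-diagonal (lookup w 0F))
  where
  h-diagonal : ∀ x → h x x x ≡ not x
  h-diagonal false = h000
  h-diagonal true  = h111

blendBit : Bool → Bool → Bool → Bool → Bool
blendBit false false y _ = y
blendBit false true  _ z = z
blendBit true  false _ z = not z
blendBit true  true  y _ = not y

blend : Vec Bool n → Vec Bool n → Bool → Bool → Vec Bool n
blend F v y z = tabulate λ j → blendBit (lookup F j) (lookup v j) y z

blend-00 : (F v : Vec Bool n) → blend F v false false ≡ F
blend-00 F v = trans (tabulate-cong λ j → at00 (lookup F j) (lookup v j)) (tabulate∘lookup F)
  where
  at00 : ∀ f t → blendBit f t false false ≡ f
  at00 false false = refl
  at00 false true  = refl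
  at00 true  false = refl
  at00 true  true  = refl

blend-11 : (F v : Vec Bool n) → blend F v true true ≡ map not F
blend-11 F v = begin
  blend F v true true           ≡⟨ tabulate-cong (λ j → at11 (lookup F j) (lookup v j)) ⟩
  tabulate (not ∘ lookup F)     ≡⟨ tabulate-∘ not (lookup F) ⟩
  map not (tabulate (lookup F)) ≡⟨ cong (map not) (tabulate∘lookup F) ⟩
  map not F                     ∎
  where
  open ≡-Reasoning
  at11 : ∀ f t → blendBit f t true true ≡ not f
  at11 false false = refl
  at11 false true  = refl
  at11 true  false = refl
  at11 true  true  = refl

blend-01 : (F v : Vec Bool n) → blend F v false true ≡ v
blend-01 F v = trans (tabulate-cong λ j → at01 (lookup F j) (lookup v j)) (tabulate∘lookup v)
  where
  at01 : ∀ f t → blendBit f t false true ≡ t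
  at01 false false = refl
  at01 false true  = refl
  at01 true  false = refl
  at01 true  true  = refl

clone-blendBit : HasNegation O → ∀ f t → Clone O 3 (ternary λ _ y z → blendBit f t y z)
clone-blendBit neg false false = proj 1F
clone-blendBit neg false true  = proj 2F
clone-blendBit neg true  false = negate neg (proj 2F)
clone-blendBit neg true  true  = negate neg (proj 1F)

nonSelfDual⇒hidden : HasNegation O → {e : BoolFun n} → Clone O n e →
                     e F ≡ e (map not F) → e v ≢ e F → HiddenDependency O
nonSelfDual⇒hidden {F = F} {v = v} neg {e} ce eF≡ ev≢eF = record
  { θ     = λ _ y z → e (blend F v y z)
  ; θ∈O   = comp ce λ j → clone-blendBit neg (lookup F j) (lookup v j)
  ; x₀    = false
  ; hides = (λ _ → trans (cong e (blend-00 F v)) (trans eF≡ (cong e (sym (blend-11 F v)))))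
          , λ eq → ev≢eF (trans (cong e (sym (blend-01 F v))) (trans eq (cong e (blend-00 F v))))
  }

SelfDual : BoolFun n → Set
SelfDual e = ∀ w → e (map not w) ≡ not (e w)

endpoints-differ : (g : Bool → Bool) → g a ≢ g b → g false ≢ g true
endpoints-differ {false} {false} g ne = λ _ → ne refl
endpoints-differ {false} {true}  g ne = ne
endpoints-differ {true}  {false} g ne = ne ∘ sym
endpoints-differ {true}  {true}  g ne = λ _ → ne refl

antipodal : (g : Bool → Bool) → g false ≢ g true → ∀ x → not (g (not x)) ≡ g x
antipodal g ne false = sym (¬-not ne)
antipodal g ne true  = sym (¬-not (ne ∘ sym))

sensitiveCoordinate : {u v : Vec Bool n} (e : BoolFun n) → e u ≢ e v →
                      ∃₂ λ i H → e (H [ i ]≔ false) ≢ e (H [ i ]≔ true)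
sensitiveCoordinate {u = []}    {[]}    e ne = contradiction refl ne
sensitiveCoordinate {u = a ∷ u} {b ∷ v} e ne with e (a ∷ u) ≟ᵇ e (b ∷ u)
... | no  ne₀ = 0F , a ∷ u , endpoints-differ (λ x → e (x ∷ u)) ne₀
... | yes eq₀ with sensitiveCoordinate (λ w → e (b ∷ w)) (λ eq → ne (trans eq₀ eq))
...   | i , H , sensitive = suc i , b ∷ H , sensitive

selfDual⇒nonconstant : {e : BoolFun n} → SelfDual e → e (replicate n false) ≢ e (replicate n true)
selfDual⇒nonconstant {n} {e} selfDual eq = not-¬ refl (trans eq e1≡¬e0)
  where
  e1≡¬e0 : e (replicate n true) ≡ not (e (replicate n false))
  e1≡¬e0 = trans (cong e (sym (map-replicate not false n))) (selfDual _)

-- On the line through H in direction i, e is x ↦ x or x ↦ ¬x; θ puts x at coordinate i and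
-- blends H, its complement and the point v off the line at the other coordinates.
sensitiveLine⇒hidden : HasNegation O → {e : BoolFun n} → Clone O n e → SelfDual e →
                       (i : Fin n) (H : Vec Bool n) → e (H [ i ]≔ false) ≢ e (H [ i ]≔ true) →
                       e v ≢ e (H [ i ]≔ lookup v i) → HiddenDependency O
sensitiveLine⇒hidden {O = O} {n} {v} neg {e} ce selfDual i H sensitive ev≢line = record
  { θ     = λ x y z → e (point x y z)
  ; θ∈O   = ext (comp ce clone-coordinate) λ w →
              cong e (tabulate∘lookup (point (w ! 0F) (w ! 1F) (w ! 2F)))
  ; x₀    = lookup v i
  ; hides = diagonal
          , λ eq → ev≢line (trans (cong e (sym off-point)) (trans eq (cong e (on-point (lookup v i)))))
  }
  where
  open ≡-Reasoning
  _!_ : Vec Bool 3 → Fin 3 → Bool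
  _!_ = lookup
  line : Bool → Bool
  line b = e (H [ i ]≔ b)
  point : Bool → Bool → Bool → Vec Bool n
  point x y z = blend H v y z [ i ]≔ x
  on-point : ∀ x → point x false false ≡ H [ i ]≔ x
  on-point x = cong (_[ i ]≔ x) (blend-00 H v)
  off-point : point (lookup v i) false true ≡ v
  off-point = trans (cong (_[ i ]≔ lookup v i) (blend-01 H v)) ([]≔-lookup v i)
  diagonal : ∀ x → e (point x false false) ≡ e (point x true true)
  diagonal x = sym (begin
    e (point x true true)              ≡⟨ cong (λ w → e (w [ i ]≔ x)) (blend-11 H v) ⟩
    e (map not H [ i ]≔ x)             ≡⟨ cong (λ b → e (map not H [ i ]≔ b)) (not-involutive x) ⟨
    e (map not H [ i ]≔ not (not x))   ≡⟨ cong e (map-[]≔ not H i) ⟨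
    e (map not (H [ i ]≔ not x))       ≡⟨ selfDual _ ⟩
    not (line (not x))                 ≡⟨ antipodal line sensitive x ⟩
    line x                             ≡⟨ cong e (on-point x) ⟨
    e (point x false false)            ∎)
  clone-coordinate : ∀ j → Clone O 3 (λ w → lookup (point (w ! 0F) (w ! 1F) (w ! 2F)) j)
  clone-coordinate j with j ≟ᶠ i
  ... | yes refl = ext (proj 0F) λ w → sym (lookup∘update i (blend H v (w ! 1F) (w ! 2F)) (w ! 0F))
  ... | no  j≢i  = ext (clone-blendBit neg (lookup H j) (lookup v j)) λ w →
    sym (trans (lookup∘update′ j≢i (blend H v (w ! 1F) (w ! 2F)) (w ! 0F)) (lookup∘tabulate _ j))

selfDual⇒hidden : HasNegation O → {e : BoolFun n} → Clone O n e → SelfDual e →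
                  (∀ i u → ∃ λ v → e v ≢ u (lookup v i)) → HiddenDependency O
selfDual⇒hidden neg {e} ce selfDual notUnary with sensitiveCoordinate e (selfDual⇒nonconstant selfDual)
... | i , H , sensitive with notUnary i (λ b → e (H [ i ]≔ b))
...   | v , ev≢line = sensitiveLine⇒hidden neg ce selfDual i H sensitive ev≢line

bit : Bool → Fin 2
bit false = 0F
bit true  = 1F

bit-injective : ∀ {a b} → bit a ≡ bit b → a ≡ b
bit-injective {false} {false} _ = refl
bit-injective {true}  {true}  _ = refl

profile : (E : List Example) → ℕ → Fin (2 ^ length E)
profile []            x = 0F
profile ((V , _) ∷ E) x = combine (bit (V x)) (profile E x)

profile-injective : ∀ E {x y} → profile E x ≡ profile E y → All (λ (V , _) → V x ≡ V y) E
profile-injective []            _  = []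
profile-injective ((V , _) ∷ E) {x} {y} eq =
  bit-injective (combine-injectiveˡ (bit (V x)) (profile E x) (bit (V y)) (profile E y) eq)
  ∷ profile-injective E (combine-injectiveʳ (bit (V x)) (profile E x) (bit (V y)) (profile E y) eq)

module Impostors {O : Ops} (H : HiddenDependency O) where
  open HiddenDependency H

  θ-args : ℕ → ℕ → ℕ → Fin 3 → Form O
  θ-args p q r 0F = var p
  θ-args p q r 1F = var q
  θ-args p q r 2F = var r

  θ-formula : ℕ → ℕ → ℕ → Form O
  θ-formula p q r = Realization.formula (realize θ∈O (θ-args p q r))

  eval-θ-formula : ∀ V p q r → eval V (θ-formula p q r) ≡ θ (V p) (V q) (V r)
  eval-θ-formula V p q r = Realization.eval-formula (realize θ∈O (θ-args p q r)) V

  θ-formula∈PL : ∀ {prop p q r} → p ∈ prop → q ∈ prop → r ∈ prop → InPL prop (θ-formula p q r)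
  θ-formula∈PL {p = p} {q} {r} p∈ q∈ r∈ x x⊑
    with Realization.vars-formula (realize θ∈O (θ-args p q r)) x x⊑
  ... | 0F , here = p∈
  ... | 1F , here = q∈
  ... | 2F , here = r∈

  θ-constant-diagonal : ∀ x b c → θ x b b ≡ θ x c c
  θ-constant-diagonal x false false = refl
  θ-constant-diagonal x true  true  = refl
  θ-constant-diagonal x false true  = proj₁ hides x
  θ-constant-diagonal x true  false = sym (proj₁ hides x)

  φ : Form O
  φ = θ-formula 0 1 1

  ψ : ℕ → ℕ → Form O
  ψ i j = θ-formula 0 (suc i) (suc j)

  ψ≗φ : ∀ {i j} V → V (suc i) ≡ V (suc j) → eval V (ψ i j) ≡ eval V φ
  ψ≗φ {i} {j} V same = begin
    eval V (ψ i j)                    ≡⟨ eval-θ-formula V 0 (suc i) (suc j) ⟩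
    θ (V 0) (V (suc i)) (V (suc j))   ≡⟨ cong (θ (V 0) (V (suc i))) same ⟨
    θ (V 0) (V (suc i)) (V (suc i))   ≡⟨ θ-constant-diagonal (V 0) _ _ ⟩
    θ (V 0) (V 1) (V 1)               ≡⟨ eval-θ-formula V 0 1 1 ⟨
    eval V φ                          ∎
    where open ≡-Reasoning

  ψ-fits : ∀ {i j} E → All (λ (V , _) → V (suc i) ≡ V (suc j)) E →
           All (Fits φ) E → All (Fits (ψ i j)) E
  ψ-fits []            []             []           = []
  ψ-fits ((V , _) ∷ E) (same ∷ sames) (fit ∷ fits) = trans (ψ≗φ V same) fit ∷ ψ-fits E sames fits

  ψ≄φ : ∀ {i j} → i ≢ j → ¬ φ ≃ ψ i j
  ψ≄φ {i} {j} i≢j φ≃ψ = proj₂ hides (begin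
    θ x₀ false true                      ≡⟨ cong₂ (θ x₀) (dec-false (i ≟ j) i≢j) (dec-true (j ≟ j) refl) ⟨
    θ (U 0) (U (suc i)) (U (suc j))      ≡⟨ eval-θ-formula U 0 (suc i) (suc j) ⟨
    eval U (ψ i j)                       ≡⟨ φ≃ψ U ⟨
    eval U φ                             ≡⟨ eval-θ-formula U 0 1 1 ⟩
    θ x₀ (U 1) (U 1)                     ≡⟨ θ-constant-diagonal x₀ _ _ ⟩
    θ x₀ false false                     ∎)
    where
    open ≡-Reasoning
    U : Assignment
    U zero    = x₀
    U (suc k) = does (k ≟ j)

  φ∈PL : ∀ n → InPL (upTo (2 + n)) φ
  φ∈PL n = θ-formula∈PL (∈-upTo⁺ (s≤s z≤n)) 1∈ 1∈
    where
    1∈ : 1 ∈ upTo (2 + n)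
    1∈ = ∈-upTo⁺ (s≤s (s≤s z≤n))

  -- Among 2 ^ |E| + 1 variables, two take the same values in all examples of E.
  impostor : ∀ K (E : List Example) → length E ℕ.≤ K → All (Fits φ) E →
            ∃ λ χ → InPL (upTo (2 + 2 ^ K)) χ × All (Fits χ) E × ¬ φ ≃ χ
  impostor K E |E|≤K fits with pigeonhole (n<1+n (2 ^ length E)) (profile E ∘ suc ∘ toℕ)
  ... | i , j , i<j , same =
    ψ (toℕ i) (toℕ j) , θ-formula∈PL (∈-upTo⁺ (s≤s z≤n)) (bounded i) (bounded j)
    , ψ-fits E (profile-injective E same) fits , ψ≄φ (<⇒≢ i<j)
    where
    bounded : (k : Fin (suc (2 ^ length E))) → suc (toℕ k) ∈ upTo (2 + 2 ^ K)
    bounded k = ∈-upTo⁺ (s≤s (ℕ.≤-trans (toℕ<n k) (s≤s (^-monoʳ-≤ 2 |E|≤K))))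

-- The converse, using excluded middle

module _ (lem : ExcludedMiddle 0ℓ) where

  counterexample : {A : Set} {f g : A → Bool} → ¬ (∀ w → f w ≡ g w) → ∃ λ w → f w ≢ g w
  counterexample ¬f≗g = em⇒dne lem λ ¬∃ → ¬f≗g λ w → em⇒dne lem λ ne → ¬∃ (w , ne)

  nonMonotoneSymbol : ¬ (O ⪯ AndOrTopBot) → ∃ λ s → NonMonotone (fn O s)
  nonMonotoneSymbol ¬O⪯M = em⇒dne lem λ ¬∃ →
    ¬O⪯M (⪯-fromGenerators λ s → monotone⇒clone (¬nonMonotone⇒monotone λ nm → ¬∃ (s , nm)))

  nonUnarySymbol : ¬ (O ⪯ NegBot) → ∃ λ s → ¬ EssentiallyUnary (fn O s)
  nonUnarySymbol ¬O⪯N = em⇒dne lem λ ¬∃ →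
    ¬O⪯N (⪯-fromGenerators λ s →
      essentiallyUnary⇒clone (em⇒dne lem λ ¬unary → ¬∃ (s , ¬unary)))

  negation⇒hidden : HasNegation O → {e : BoolFun (suc n)} → Clone O (suc n) e →
                    ¬ EssentiallyUnary e → HiddenDependency O
  negation⇒hidden neg {e} ce ¬unary with lem {∃ λ F → e F ≡ e (map not F)}
  ... | yes (F , eF≡) =
    nonSelfDual⇒hidden neg ce eF≡ (proj₂ (counterexample λ e≡ → ¬unary (0F , const (e F) , e≡)))
  ... | no  ¬∃       = selfDual⇒hidden neg ce (λ w → ¬-not λ eq → ¬∃ (w , sym eq))
                         λ i u → counterexample λ e≡ → ¬unary (i , u , e≡)

  ¬cond1⇒hidden : ¬ Cond1 O → HiddenDependency O
  ¬cond1⇒hidden ¬c1 with nonMonotoneSymbol (¬c1 ∘ inj₁)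
  ... | s , nonMonotone with nonMonotone⇒ternary (base s) nonMonotone
  ...   | h , ch , h010 , h011 with ternaryNonMonotone⇒hidden⊎negation {h = h} ch h010 h011
  ...     | inj₁ hidden = hidden
  ...     | inj₂ neg with nonUnarySymbol (¬c1 ∘ inj₂)
  ...       | s′ , ¬unary = negation⇒hidden neg (base s′) ¬unary

  cond2⇒cond1 : Cond2 O → Cond1 O
  cond2⇒cond1 c2 = em⇒dne lem λ ¬c1 →
    let open Impostors (¬cond1⇒hidden ¬c1)
        E , fits , unique = c2 φ
        χ , _ , χ-fits , φ≄χ = impostor (length E) E ℕ.≤-refl fits
    in φ≄χ (unique χ tt χ-fits)

  cond3⇒cond1 : Cond3 O → Cond1 O
  cond3⇒cond1 (f , c3) = em⇒dne lem λ ¬c1 →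
    let open Impostors (¬cond1⇒hidden ¬c1)
        m , size = dagSize lem φ
        E , |E|≤fm , fits , unique = c3 (upTo (2 + 2 ^ f m)) φ (φ∈PL (2 ^ f m)) m size
        χ , χ∈PL , χ-fits , φ≄χ = impostor (f m) E |E|≤fm fits
    in φ≄χ (unique χ χ∈PL χ-fits)

theorem3p19 : ExcludedMiddle 0ℓ → (O : Ops) → IsSet O →
    (Cond1 O ⇔ Cond2 O) × (Cond1 O ⇔ Cond3 O)
theorem3p19 lem O _ = mk⇔ cond1⇒cond2 (cond2⇒cond1 lem) , mk⇔ cond1⇒cond3 (cond3⇒cond1 lem)
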